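{- Let $a,b$ be distinct relatively prime positive integers, one of which is even. If $a$ is even, then the Ulam sequence $\mathcal{U}(a,b)$ has at least $1+a/2$ even terms; if $b$ is even, then $\mathcal{U}(a,b)$ has at least $1+b/2$ even terms.
   Context: For distinct positive integers $a,b$, the Ulam sequence $\mathcal{U}(a,b)$ is the increasing sequence whose first two terms are $a$ and $b$ and in which each subsequent term is the smallest integer larger than all previous terms that can be written as the sum of two distinct earlier terms in exactly one way (unordered pairs). -}

module Defs where

open import Data.Nat using (ℕ; zero; suc; _+_; _∸_; _⊓_; _⊔_; _≡ᵇ_; _<ᵇ_; _%_)
open import Data.Bool using (Bool; true; false; _∧_; _∨_; if_then_else_)
open import Data.List using (List; []; _∷_; _++_; filter; length)
open import Data.Bool.ListAction using (any)
open import Relation.Nullary.Decidable using (Dec; yes; no)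
open import Relation.Binary.PropositionalEquality using (_≡_)
open import Data.Bool.Properties using (T?)
open import Data.Bool using (T)

elemᵇ : ℕ → List ℕ → Bool
elemᵇ x L = any (λ y → x ≡ᵇ y) L

-- number of ways to write x as u + v with u < v, both u and v in L
-- (unordered pairs of distinct elements of L)
reps : List ℕ → ℕ → ℕ
reps L x = length (filter (λ u → T? ((u + u <ᵇ x) ∧ elemᵇ (x ∸ u) L)) L)

-- ulamUpTo a b N : the terms of the Ulam sequence U(a,b) that are ≤ N,
-- in increasing order.
-- A number x > max(a,b) is a term iff it is the sum of two distinct
-- earlier terms (terms < x) in exactly one way.
-- one extension step: given the terms L that are ≤ n, decide whether x = suc n is a term
stepU : ℕ → ℕ → List ℕ → ℕ → List ℕ
stepU lo hi L x =
  if ((x ≡ᵇ lo) ∨ (x ≡ᵇ hi) ∨ ((hi <ᵇ x) ∧ (reps L x ≡ᵇ 1)))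
  then L ++ (x ∷ [])
  else L

ulamUpTo : ℕ → ℕ → ℕ → List ℕ
ulamUpTo a b zero = []
ulamUpTo a b (suc n) = stepU (a ⊓ b) (a ⊔ b) (ulamUpTo a b n) (suc n)

evenTermsUpTo : ℕ → ℕ → ℕ → ℕ
evenTermsUpTo a b N = length (filter (λ u → T? (u % 2 ≡ᵇ 0)) (ulamUpTo a b N))

-- Every term of U(a,b) is a combination i·a + j·b with i, j ≥ 0.  For coprime a, b ≥ 2,
-- a joint strong induction shows that no k·b with 2 ≤ k ≤ a and no i·a with 2 ≤ i ≤ b is a
-- term: splitting such a number as a sum of two smaller terms, coprimality forces both
-- summands onto one axis, where the larger one is again such a multiple.  Hence for j < a the
-- only splitting of a + (j+1)·b is b + (a + j·b), so the whole column a, a + b, …, a + a·b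
-- consists of terms (for b = 1 the same holds since 2, …, a − 1 are not terms).  When a is
-- even, the terms a + j·b with j even are 1 + a/2 distinct even terms.
{-# OPTIONS --safe #-}
module Submission where

open import Defs
open import Data.Nat using (ℕ; _+_; _<_; _≤_; _/_)
open import Data.Nat.Divisibility using (_∣_)
open import Data.Nat.Coprimality using (Coprime)
open import Data.Product using (_×_; ∃-syntax)
open import Data.Sum using (_⊎_)
open import Relation.Binary.PropositionalEquality using (_≢_)

open import Data.Nat
open import Data.Nat.Properties
open import Data.Nat.Divisibility using (divides-refl; ∣-refl; ∣⇒≤; n∣m*n; ∣m+n∣m⇒∣n)
open import Data.Nat.Coprimality using (coprime-divisor) renaming (sym to coprime-sym)
open import Data.Nat.Induction using (<-rec)
open import Data.Nat.Tactic.RingSolver using (solve-∀)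
open import Data.Nat.DivMod using (m*n%n≡0; m*n/n≡m)
open import Algebra.Properties.CommutativeSemigroup +-commutativeSemigroup using (x∙yz≈y∙xz)
open import Data.Bool using (Bool; true; false; T; _∧_; _∨_; if_then_else_)
open import Data.Bool.Properties using (T?; T-∨; T-∧)
open import Data.List using (List; [_]; _++_; filter; length)
open import Data.List.Properties using (filter-++; length-++; filter-accept; filter-reject)
open import Data.List.Relation.Unary.Any using (here)
open import Data.List.Relation.Unary.Any.Properties using (any⁺; any⁻; ++⁺ˡ; ++⁺ʳ; ++⁻)
open import Data.Product using (_,_; proj₁; proj₂; ∃₂; map₁; map₂; swap)
open import Data.Sum using (inj₁; inj₂)
open import Data.Empty using (⊥-elim)
open import Data.Unit using (tt)
open import Function using (_∘_)
open import Function.Bundles using (Equivalence)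
open import Relation.Nullary using (¬_; yes; no)
open import Relation.Binary.Definitions using (tri<; tri≈; tri>)
open import Relation.Binary.PropositionalEquality
  using (_≡_; refl; sym; trans; cong; subst; subst₂; module ≡-Reasoning)

count : (ℕ → Bool) → List ℕ → ℕ
count Q xs = length (filter (λ u → T? (Q u)) xs)

count-++ : ∀ Q xs ys → count Q (xs ++ ys) ≡ count Q xs + count Q ys
count-++ Q xs ys = trans (cong length (filter-++ (T? ∘ Q) xs ys)) (length-++ (filter (T? ∘ Q) xs))

count-[-]-accept : ∀ Q {y} → T (Q y) → count Q [ y ] ≡ 1
count-[-]-accept Q q = cong length (filter-accept (T? ∘ Q) q)

count-[-]-reject : ∀ Q {y} → ¬ T (Q y) → count Q [ y ] ≡ 0
count-[-]-reject Q ¬q = cong length (filter-reject (T? ∘ Q) ¬q)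

elemᵇ-++⁺ˡ : ∀ v xs {ys} → T (elemᵇ v xs) → T (elemᵇ v (xs ++ ys))
elemᵇ-++⁺ˡ v xs h = any⁺ (v ≡ᵇ_) (++⁺ˡ (any⁻ (v ≡ᵇ_) xs h))

elemᵇ-++-[-]⁺ : ∀ v xs → T (elemᵇ v (xs ++ [ v ]))
elemᵇ-++-[-]⁺ v xs = any⁺ (v ≡ᵇ_) (++⁺ʳ xs (here (≡⇒≡ᵇ v v refl)))

elemᵇ-++-[-]⁻ : ∀ v xs y → T (elemᵇ v (xs ++ [ y ])) → T (elemᵇ v xs) ⊎ v ≡ y
elemᵇ-++-[-]⁻ v xs y h with ++⁻ xs (any⁻ (v ≡ᵇ_) (xs ++ [ y ]) h)
... | inj₁ p        = inj₁ (any⁺ (v ≡ᵇ_) p)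
... | inj₂ (here q) = inj₂ (≡ᵇ⇒≡ v y q)

if-cases : ∀ {A : Set} c (p q : A) → (T c × (if c then p else q) ≡ p) ⊎ (¬ T c × (if c then p else q) ≡ q)
if-cases true  p q = inj₁ (tt , refl)
if-cases false p q = inj₂ ((λ ()) , refl)

module Ulam (a b : ℕ) where

  U : ℕ → List ℕ
  U = ulamUpTo a b

  Initial : ℕ → Set
  Initial x = x ≡ a ⊎ x ≡ b

  -- reps (U n) (suc n) is definitionally count (lowerSummandᵇ n) (U n), and accepted n is
  -- the guard under which stepU appends suc n.
  lowerSummandᵇ : ℕ → ℕ → Bool
  lowerSummandᵇ n u = (u + u <ᵇ suc n) ∧ elemᵇ (suc n ∸ u) (U n)

  isMinᵇ isMaxᵇ isUniqueSumᵇ accepted : ℕ → Bool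
  isMinᵇ n = suc n ≡ᵇ a ⊓ b
  isMaxᵇ n = suc n ≡ᵇ a ⊔ b
  isUniqueSumᵇ n = (a ⊔ b <ᵇ suc n) ∧ (reps (U n) (suc n) ≡ᵇ 1)
  accepted n = isMinᵇ n ∨ isMaxᵇ n ∨ isUniqueSumᵇ n

  U-suc : ∀ n → (T (accepted n) × U (suc n) ≡ U n ++ [ suc n ]) ⊎ (¬ T (accepted n) × U (suc n) ≡ U n)
  U-suc n = if-cases (accepted n) _ _

  extremal⇒initial : ∀ {x} → x ≡ a ⊓ b ⊎ x ≡ a ⊔ b → Initial x
  extremal⇒initial (inj₁ refl) = ⊓-sel a b
  extremal⇒initial (inj₂ refl) = ⊔-sel a b

  initial⇒extremal : ∀ {x} → Initial x → x ≡ a ⊓ b ⊎ x ≡ a ⊔ b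
  initial⇒extremal i with ≤-total a b
  initial⇒extremal (inj₁ refl) | inj₁ a≤b = inj₁ (sym (m≤n⇒m⊓n≡m a≤b))
  initial⇒extremal (inj₂ refl) | inj₁ a≤b = inj₂ (sym (m≤n⇒m⊔n≡n a≤b))
  initial⇒extremal (inj₁ refl) | inj₂ b≤a = inj₂ (sym (m≥n⇒m⊔n≡m b≤a))
  initial⇒extremal (inj₂ refl) | inj₂ b≤a = inj₁ (sym (m≥n⇒m⊓n≡n b≤a))

  accepted⇒ : ∀ n → T (accepted n) → Initial (suc n) ⊎ (a ⊔ b < suc n × reps (U n) (suc n) ≡ 1)
  accepted⇒ n h with Equivalence.to (T-∨ {isMinᵇ n}) h
  ... | inj₁ p = inj₁ (extremal⇒initial (inj₁ (≡ᵇ⇒≡ _ _ p)))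
  ... | inj₂ h′ with Equivalence.to (T-∨ {isMaxᵇ n}) h′
  ...   | inj₁ p = inj₁ (extremal⇒initial (inj₂ (≡ᵇ⇒≡ _ _ p)))
  ...   | inj₂ p = let (lt , r) = Equivalence.to (T-∧ {a ⊔ b <ᵇ suc n}) p in inj₂ (<ᵇ⇒< _ _ lt , ≡ᵇ⇒≡ _ _ r)

  initial⇒accepted : ∀ n → Initial (suc n) → T (accepted n)
  initial⇒accepted n i with initial⇒extremal i
  ... | inj₁ e = Equivalence.from (T-∨ {isMinᵇ n}) (inj₁ (≡⇒≡ᵇ _ _ e))
  ... | inj₂ e = Equivalence.from (T-∨ {isMinᵇ n}) (inj₂ (Equivalence.from (T-∨ {isMaxᵇ n}) (inj₁ (≡⇒≡ᵇ _ _ e))))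

  unique⇒accepted : ∀ n → a ⊔ b < suc n → reps (U n) (suc n) ≡ 1 → T (accepted n)
  unique⇒accepted n lt r = Equivalence.from (T-∨ {isMinᵇ n}) (inj₂ (Equivalence.from (T-∨ {isMaxᵇ n}) (inj₂
    (Equivalence.from (T-∧ {a ⊔ b <ᵇ suc n}) (<⇒<ᵇ lt , ≡⇒≡ᵇ _ _ r)))))

  record Listed (v n : ℕ) : Set where
    constructor listed
    field elem : T (elemᵇ v (U n))

  listed-suc⁻ : ∀ {v} n → Listed v (suc n) → Listed v n ⊎ (v ≡ suc n × T (accepted n))
  listed-suc⁻ {v} n (listed l) with U-suc n
  ... | inj₂ (_ , e) = inj₁ (listed (subst (T ∘ elemᵇ v) e l))
  ... | inj₁ (c , e) with elemᵇ-++-[-]⁻ v (U n) (suc n) (subst (T ∘ elemᵇ v) e l)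
  ...   | inj₁ l′ = inj₁ (listed l′)
  ...   | inj₂ v≡ = inj₂ (v≡ , c)

  listed-suc⁺ : ∀ {v} n → Listed v n → Listed v (suc n)
  listed-suc⁺ {v} n (listed l) with U-suc n
  ... | inj₂ (_ , e) = listed (subst (T ∘ elemᵇ v) (sym e) l)
  ... | inj₁ (_ , e) = listed (subst (T ∘ elemᵇ v) (sym e) (elemᵇ-++⁺ˡ v (U n) l))

  listed-new : ∀ n → T (accepted n) → Listed (suc n) (suc n)
  listed-new n c with U-suc n
  ... | inj₂ (¬c , _) = ⊥-elim (¬c c)
  ... | inj₁ (_ , e) = listed (subst (T ∘ elemᵇ (suc n)) (sym e) (elemᵇ-++-[-]⁺ (suc n) (U n)))

  listed-bounds : ∀ {v} n → Listed v n → 0 < v × v ≤ n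
  listed-bounds zero (listed ())
  listed-bounds (suc n) l with listed-suc⁻ n l
  ... | inj₁ l′ = let (pos , v≤n) = listed-bounds n l′ in pos , m≤n⇒m≤1+n v≤n
  ... | inj₂ (refl , _) = z<s , ≤-refl

  listed-mono : ∀ {v n m} → n ≤ m → Listed v n → Listed v m
  listed-mono {m = zero} z≤n l = l
  listed-mono {m = suc m} n≤1+m l with m≤n⇒m<n∨m≡n n≤1+m
  ... | inj₂ refl = l
  ... | inj₁ (s≤s n≤m) = listed-suc⁺ m (listed-mono n≤m l)

  Term : ℕ → Set
  Term v = Listed v v

  listed⇒term : ∀ {v} n → Listed v n → Term v
  listed⇒term zero (listed ())
  listed⇒term (suc n) l with listed-suc⁻ n l
  ... | inj₁ l′ = listed⇒term n l′
  ... | inj₂ (refl , _) = l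

  term-pos : ∀ {v} → Term v → 0 < v
  term-pos {v} t = proj₁ (listed-bounds v t)

  term-accepted : ∀ {n} → Term (suc n) → T (accepted n)
  term-accepted {n} t with listed-suc⁻ n t
  ... | inj₁ l = ⊥-elim (<-irrefl refl (proj₂ (listed-bounds n l)))
  ... | inj₂ (_ , c) = c

  count-U-suc : ∀ Q m →
    (T (accepted m) × count Q (U (suc m)) ≡ count Q (U m) + count Q [ suc m ]) ⊎
    (¬ T (accepted m) × count Q (U (suc m)) ≡ count Q (U m))
  count-U-suc Q m with U-suc m
  ... | inj₁ (c , e)  = inj₁ (c , trans (cong (count Q) e) (count-++ Q (U m) [ suc m ]))
  ... | inj₂ (¬c , e) = inj₂ (¬c , cong (count Q) e)

  count-U-suc-unchanged : ∀ Q m → (T (accepted m) → ¬ T (Q (suc m))) → count Q (U (suc m)) ≡ count Q (U m)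
  count-U-suc-unchanged Q m rejected with count-U-suc Q m
  ... | inj₂ (_ , e) = e
  ... | inj₁ (c , e) = begin
    count Q (U (suc m))                ≡⟨ e ⟩
    count Q (U m) + count Q [ suc m ]  ≡⟨ cong (count Q (U m) +_) (count-[-]-reject Q (rejected c)) ⟩
    count Q (U m) + 0                  ≡⟨ +-identityʳ _ ⟩
    count Q (U m)                      ∎
    where open ≡-Reasoning

  count-U-suc-added : ∀ Q m → Term (suc m) → T (Q (suc m)) → count Q (U (suc m)) ≡ suc (count Q (U m))
  count-U-suc-added Q m t q with count-U-suc Q m
  ... | inj₂ (¬c , _) = ⊥-elim (¬c (term-accepted t))
  ... | inj₁ (_ , e) = begin
    count Q (U (suc m))                ≡⟨ e ⟩
    count Q (U m) + count Q [ suc m ]  ≡⟨ cong (count Q (U m) +_) (count-[-]-accept Q q) ⟩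
    count Q (U m) + 1                  ≡⟨ +-comm _ 1 ⟩
    suc (count Q (U m))                ∎
    where open ≡-Reasoning

  count-witness : ∀ Q m → count Q (U m) ≢ 0 → ∃[ u ] (Term u × u ≤ m × T (Q u))
  count-witness Q zero c≢0 = ⊥-elim (c≢0 refl)
  count-witness Q (suc m) c≢0 with T? (accepted m) | T? (Q (suc m))
  ... | yes c | yes q = suc m , listed-new m c , ≤-refl , q
  ... | yes _ | no ¬q = map₂ (map₂ (map₁ m≤n⇒m≤1+n))
    (count-witness Q m (c≢0 ∘ trans (count-U-suc-unchanged Q m λ _ → ¬q)))
  ... | no ¬c | _     = map₂ (map₂ (map₁ m≤n⇒m≤1+n))
    (count-witness Q m (c≢0 ∘ trans (count-U-suc-unchanged Q m λ c → ⊥-elim (¬c c))))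

  count-≡0 : ∀ Q m → (∀ {u} → Term u → u ≤ m → ¬ T (Q u)) → count Q (U m) ≡ 0
  count-≡0 Q m none with count Q (U m) ≟ 0
  ... | yes c≡0 = c≡0
  ... | no c≢0  = let (_ , t , u≤m , q) = count-witness Q m c≢0 in ⊥-elim (none t u≤m q)

  count-≡1 : ∀ Q m {w} → Term w → w ≤ m → T (Q w) →
             (∀ {u} → Term u → u ≤ m → T (Q u) → u ≡ w) → count Q (U m) ≡ 1
  count-≡1 Q zero t z≤n _ _ = ⊥-elim (<-irrefl refl (term-pos t))
  count-≡1 Q (suc m) t w≤1+m q unique with m≤n⇒m<n∨m≡n w≤1+m
  ... | inj₁ (s≤s w≤m) =
    trans (count-U-suc-unchanged Q m (λ c qm → <-irrefl (sym (unique (listed-new m c) ≤-refl qm)) (s≤s w≤m)))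
          (count-≡1 Q m t w≤m q (λ tu u≤m → unique tu (m≤n⇒m≤1+n u≤m)))
  ... | inj₂ refl =
    trans (count-U-suc-added Q m t q)
          (cong suc (count-≡0 Q m (λ tu u≤m qu → <-irrefl (unique tu (m≤n⇒m≤1+n u≤m) qu) (s≤s u≤m))))

  count-suc-mono : ∀ Q m → count Q (U m) ≤ count Q (U (suc m))
  count-suc-mono Q m with count-U-suc Q m
  ... | inj₁ (_ , e) = ≤-trans (m≤m+n _ _) (≤-reflexive (sym e))
  ... | inj₂ (_ , e) = ≤-reflexive (sym e)

  count-mono : ∀ Q {n m} → n ≤ m → count Q (U n) ≤ count Q (U m)
  count-mono Q {m = zero} z≤n = ≤-refl
  count-mono Q {m = suc m} n≤1+m with m≤n⇒m<n∨m≡n n≤1+m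
  ... | inj₂ refl = ≤-refl
  ... | inj₁ (s≤s n≤m) = ≤-trans (count-mono Q n≤m) (count-suc-mono Q m)

  count-<-at-term : ∀ Q {x y} → Term x → T (Q x) → y < x → count Q (U y) < count Q (U x)
  count-<-at-term Q {suc n} t q (s≤s y≤n) =
    ≤-trans (s≤s (count-mono Q y≤n)) (≤-reflexive (sym (count-U-suc-added Q n t q)))

  record Split (x u v : ℕ) : Set where
    constructor split
    field
      lower-term  : Term u
      upper-term  : Term v
      sum         : u + v ≡ x
      lower<upper : u < v

  lowerSummand⇒split : ∀ {n u} → Term u → u ≤ n → T (lowerSummandᵇ n u) → Split (suc n) u (suc n ∸ u)
  lowerSummand⇒split {n} {u} tu u≤n q =
    split tu (listed⇒term n (listed complement-listed)) sum
      (+-cancelˡ-< u u (suc n ∸ u) (subst (u + u <_) (sym sum) (<ᵇ⇒< _ _ doubled<)))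
    where
      doubled< = proj₁ (Equivalence.to (T-∧ {u + u <ᵇ suc n}) q)
      complement-listed = proj₂ (Equivalence.to (T-∧ {u + u <ᵇ suc n}) q)
      sum : u + (suc n ∸ u) ≡ suc n
      sum = m+[n∸m]≡n (m≤n⇒m≤1+n u≤n)

  split⇒lowerSummand : ∀ {n u v} → Split (suc n) u v → T (lowerSummandᵇ n u)
  split⇒lowerSummand {n} {u} {v} (split tu tv sum u<v) = Equivalence.from (T-∧ {u + u <ᵇ suc n})
    (<⇒<ᵇ (subst (u + u <_) sum (+-monoʳ-< u u<v)) ,
     Listed.elem (subst (λ w → Listed w n) v≡ (listed-mono v≤n tv)))
    where
      v≡ : v ≡ suc n ∸ u
      v≡ = trans (sym (m+n∸m≡n u v)) (cong (_∸ u) sum)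
      v≤n : v ≤ n
      v≤n = ≤-pred (subst (v <_) sum (m<n+m v (term-pos tu)))

  initial-term : ∀ {x} → 0 < x → Initial x → Term x
  initial-term {suc n} _ i = listed-new n (initial⇒accepted n i)

  term-split : ∀ {x} → Term x → Initial x ⊎ ∃₂ (Split x)
  term-split {zero} (listed ())
  term-split {suc n} t with accepted⇒ n (term-accepted t)
  ... | inj₁ i = inj₁ i
  ... | inj₂ (_ , once) =
    let (u , tu , u≤n , q) = count-witness (lowerSummandᵇ n) n (λ none → 1+n≢0 (trans (sym once) none))
    in inj₂ (u , suc n ∸ u , lowerSummand⇒split tu u≤n q)

  unique-split⇒term : ∀ {x w w′} → a < x → b < x → Split x w w′ → (∀ {u v} → Split x u v → u ≡ w) → Term x
  unique-split⇒term {suc n} {w} a<x b<x s@(split tw tw′ sum _) unique =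
    listed-new n (unique⇒accepted n (⊔-lub a<x b<x)
      (count-≡1 (lowerSummandᵇ n) n tw w≤n (split⇒lowerSummand s)
        (λ tu u≤n q → unique (lowerSummand⇒split tu u≤n q))))
    where
      w≤n : w ≤ n
      w≤n = ≤-pred (subst (w <_) sum (m<m+n w (term-pos tw′)))

  splits-through⇒term : ∀ {x c d} → a < x → b < x → Term c → Term d → c + d ≡ x → c ≢ d →
                        (∀ {u v} → Split x u v → u ≡ c ⊎ v ≡ c) → Term x
  splits-through⇒term {x} {c} {d} a<x b<x tc td sum c≢d through with <-cmp c d
  ... | tri≈ _ c≡d _ = ⊥-elim (c≢d c≡d)
  ... | tri< c<d _ _ = unique-split⇒term a<x b<x (split tc td sum c<d) unique
    where
      unique : ∀ {u v} → Split x u v → u ≡ c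
      unique s@(split _ _ uv u<v) with through s
      ... | inj₁ u≡c = u≡c
      ... | inj₂ refl = ⊥-elim (<-asym c<d (subst (_< c) u≡d u<v))
        where u≡d = +-cancelʳ-≡ c _ d (trans uv (trans (sym sum) (+-comm c d)))
  ... | tri> _ _ d<c = unique-split⇒term a<x b<x (split td tc (trans (+-comm d c) sum) d<c) unique
    where
      unique : ∀ {u v} → Split x u v → u ≡ d
      unique s@(split _ _ uv u<v) with through s
      ... | inj₁ refl = ⊥-elim (<-asym d<c (subst (c <_) v≡d u<v))
        where v≡d = +-cancelˡ-≡ c _ d (trans uv (sym sum))
      ... | inj₂ refl = +-cancelʳ-≡ c _ d (trans uv (trans (sym sum) (+-comm c d)))

  split-upper< : ∀ {x u v} → Split x u v → v < x
  split-upper< {v = v} (split tu _ sum _) = subst (v <_) sum (m<n+m v (term-pos tu))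

  split-multiples⇒upper≢1 : ∀ {x} c i k → Split x (i * c) (k * c) → k ≢ 1
  split-multiples⇒upper≢1 c zero    k (split (listed ()) _ _ _) _
  split-multiples⇒upper≢1 c (suc i) k (split _ _ _ u<v) refl =
    m+n≮m c (i * c) (subst (c + i * c <_) (+-identityʳ c) u<v)

  count-increasing-terms : ∀ Q (f : ℕ → ℕ) → (∀ k → f k < f (suc k)) → ∀ m →
                           (∀ {k} → k ≤ m → Term (f k) × T (Q (f k))) → m < count Q (U (f m))
  count-increasing-terms Q f f-inc zero hit =
    let (t , q) = hit z≤n in count-<-at-term Q t q (term-pos t)
  count-increasing-terms Q f f-inc (suc m) hit =
    let (t , q) = hit ≤-refl
    in ≤-<-trans (count-increasing-terms Q f f-inc m (hit ∘ m≤n⇒m≤1+n)) (count-<-at-term Q t q (f-inc m))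

coprime⇒∤ : ∀ {a b} → Coprime a b → 1 < b → ¬ b ∣ a
coprime⇒∤ cop 1<b b∣a = <-irrefl (sym (cop (b∣a , ∣-refl))) 1<b

lattice-+ : ∀ i₁ j₁ i₂ j₂ a b → (i₁ * a + j₁ * b) + (i₂ * a + j₂ * b) ≡ (i₁ + i₂) * a + (j₁ + j₂) * b
lattice-+ = solve-∀

module _ {a b : ℕ} .{{_ : NonZero a}} .{{_ : NonZero b}} (cop : Coprime a b) where

  lattice≡multiple : ∀ {I J K} → K ≤ a → I * a + J * b ≡ K * b → (I ≡ 0 × J ≡ K) ⊎ (J ≡ 0 × I ≤ b)
  lattice≡multiple {zero} {J} {K} _ eq = inj₁ (refl , *-cancelʳ-≡ J K b eq)
  lattice≡multiple {I@(suc _)} {J} {K} K≤a eq = inj₂ (J≡0 , *-cancelʳ-≤ I b a (m+n≤o⇒m≤o (I * a) below-ba))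
    where
      open ≤-Reasoning
      b∣I : b ∣ I
      b∣I = coprime-divisor (coprime-sym cop) (subst (b ∣_) (*-comm I a)
              (∣m+n∣m⇒∣n (subst (b ∣_) (trans (sym eq) (+-comm (I * a) (J * b))) (n∣m*n K)) (n∣m*n J)))
      below-ba : I * a + J * b ≤ b * a
      below-ba = begin
        I * a + J * b  ≡⟨ eq ⟩
        K * b          ≤⟨ *-monoˡ-≤ b K≤a ⟩
        a * b          ≡⟨ *-comm a b ⟩
        b * a          ∎
      J≡0 : J ≡ 0
      J≡0 = m*n≡0⇒m≡0 J b (n≤0⇒n≡0 (+-cancelˡ-≤ (I * a) (J * b) 0 (begin
        I * a + J * b  ≤⟨ below-ba ⟩
        b * a          ≤⟨ *-monoˡ-≤ a (∣⇒≤ b∣I) ⟩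
        I * a          ≡⟨ +-identityʳ (I * a) ⟨
        I * a + 0      ∎)))

  lattice≡column : 1 < b → ∀ {I J K} → K ≤ a → I * a + J * b ≡ a + K * b →
                   (I ≡ 1 × J ≡ K) ⊎ (J ≡ 0 × I ≤ suc b)
  lattice≡column 1<b {zero} {J} {K} _ eq = ⊥-elim (coprime⇒∤ cop 1<b
    (∣m+n∣m⇒∣n (subst (b ∣_) (trans eq (+-comm a (K * b))) (n∣m*n J)) (n∣m*n K)))
  lattice≡column 1<b {suc I} {J} {K} K≤a eq
    with lattice≡multiple {I} K≤a (+-cancelˡ-≡ a (I * a + J * b) (K * b) (trans (sym (+-assoc a (I * a) (J * b))) eq))
  ... | inj₁ (refl , J≡K) = inj₁ (refl , J≡K)
  ... | inj₂ (J≡0 , I≤b)  = inj₂ (J≡0 , s≤s I≤b)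

ulamUpTo-comm : ∀ a b n → ulamUpTo a b n ≡ ulamUpTo b a n
ulamUpTo-comm a b zero = refl
ulamUpTo-comm a b (suc n) rewrite ⊓-comm a b | ⊔-comm a b | ulamUpTo-comm a b n = refl

term-comm : ∀ {a b x} → Ulam.Term a b x → Ulam.Term b a x
term-comm {a} {b} {x} t = record { elem = subst (T ∘ elemᵇ x) (ulamUpTo-comm a b x) (Ulam.Listed.elem t) }

NoProperMultipleTerm : ℕ → ℕ → ℕ → Set
NoProperMultipleTerm a b y = ∀ {k} → k ≤ a → k * b ≡ y → Ulam.Term a b y → k ≡ 1

module Lattice (a b : ℕ) (a≥2 : 2 ≤ a) (b≥2 : 2 ≤ b) (cop : Coprime a b) where
  open Ulam a b

  instance
    a-nonZero : NonZero a
    a-nonZero = >-nonZero (≤-trans (s≤s z≤n) a≥2)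
    b-nonZero : NonZero b
    b-nonZero = >-nonZero (≤-trans (s≤s z≤n) b≥2)

  InLattice : ℕ → Set
  InLattice x = ∃₂ λ i j → x ≡ i * a + j * b

  term⇒lattice : ∀ x → Term x → InLattice x
  term⇒lattice = <-rec (λ x → Term x → InLattice x) go
    where
      go : ∀ x → (∀ {y} → y < x → Term y → InLattice y) → Term x → InLattice x
      go x ih t with term-split t
      ... | inj₁ (inj₁ refl) = 1 , 0 , sym (trans (+-identityʳ (a + 0)) (+-identityʳ a))
      ... | inj₁ (inj₂ refl) = 0 , 1 , sym (+-identityʳ b)
      ... | inj₂ (u , v , split tu tv refl _)
        with ih (m<m+n u (term-pos tv)) tu | ih (m<n+m v (term-pos tu)) tv
      ...   | i₁ , j₁ , refl | i₂ , j₂ , refl = i₁ + i₂ , j₁ + j₂ , lattice-+ i₁ j₁ i₂ j₂ a b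

  split-coordinates : ∀ {x} i₁ j₁ i₂ j₂ → Split x (i₁ * a + j₁ * b) (i₂ * a + j₂ * b) →
                      (i₁ + i₂) * a + (j₁ + j₂) * b ≡ x
  split-coordinates i₁ j₁ i₂ j₂ (split _ _ sum _) = trans (sym (lattice-+ i₁ j₁ i₂ j₂ a b)) sum

  split-on-a-axis : ∀ {x} i₁ i₂ → Split x (i₁ * a + 0 * b) (i₂ * a + 0 * b) → Split x (i₁ * a) (i₂ * a)
  split-on-a-axis i₁ i₂ = subst₂ (Split _) (+-identityʳ _) (+-identityʳ _)

  no-proper-multiple-step : ∀ y → (∀ {z} → z < y → NoProperMultipleTerm a b z × NoProperMultipleTerm b a z) →
                            NoProperMultipleTerm a b y
  no-proper-multiple-step _ ih {k} k≤a refl t with term-split t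
  ... | inj₁ (inj₁ kb≡a) = ⊥-elim (coprime⇒∤ cop b≥2 (subst (b ∣_) kb≡a (n∣m*n k)))
  ... | inj₁ (inj₂ kb≡b) = *-cancelʳ-≡ k 1 b (trans kb≡b (sym (*-identityˡ b)))
  ... | inj₂ (u , v , s@(split tu tv _ _)) with term⇒lattice u tu | term⇒lattice v tv
  ...   | i₁ , j₁ , refl | i₂ , j₂ , refl with lattice≡multiple cop k≤a (split-coordinates i₁ j₁ i₂ j₂ s)
  ...     | inj₁ (I≡0 , J≡k) with m+n≡0⇒m≡0 i₁ I≡0 | m+n≡0⇒n≡0 i₁ {i₂} I≡0
  ...       | refl | refl = ⊥-elim (split-multiples⇒upper≢1 b j₁ j₂ s
                (proj₁ (ih (split-upper< s)) (≤-trans (m≤n+m j₂ j₁) (≤-trans (≤-reflexive J≡k) k≤a)) refl tv))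
  no-proper-multiple-step _ ih {k} k≤a refl t
        | inj₂ (u , v , s) | i₁ , j₁ , refl | i₂ , j₂ , refl | inj₂ (J≡0 , I≤b)
        with m+n≡0⇒m≡0 j₁ J≡0 | m+n≡0⇒n≡0 j₁ {j₂} J≡0
  ...   | refl | refl = ⊥-elim (split-multiples⇒upper≢1 a i₁ i₂ s′
                (proj₂ (ih (split-upper< s′)) (m+n≤o⇒n≤o i₁ I≤b) refl (term-comm (Split.upper-term s′))))
    where s′ = split-on-a-axis i₁ i₂ s

no-proper-multiple-term : ∀ {a b} → 2 ≤ a → 2 ≤ b → Coprime a b → ∀ y →
                          NoProperMultipleTerm a b y × NoProperMultipleTerm b a y
no-proper-multiple-term {a} {b} a≥2 b≥2 cop = <-rec _ λ y ih →
  Lattice.no-proper-multiple-step a b a≥2 b≥2 cop y ih ,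
  Lattice.no-proper-multiple-step b a b≥2 a≥2 (coprime-sym cop) y (swap ∘ ih)

module _ {a b : ℕ} (a≥2 : 2 ≤ a) (b≥2 : 2 ≤ b) (cop : Coprime a b) where
  open Ulam a b
  open Lattice a b a≥2 b≥2 cop

  b-multiple⇒unit : ∀ {k} → Term (k * b) → k ≤ a → k ≡ 1
  b-multiple⇒unit t k≤a = proj₁ (no-proper-multiple-term a≥2 b≥2 cop _) k≤a refl t

  a-multiple⇒unit : ∀ {i} → Term (i * a) → i ≤ b → i ≡ 1
  a-multiple⇒unit t i≤b = proj₂ (no-proper-multiple-term a≥2 b≥2 cop _) i≤b refl (term-comm t)

  lattice-column-term : ∀ {j} → j ≤ a → Term (a + j * b)
  lattice-column-term {zero} _ = subst Term (sym (+-identityʳ a)) (initial-term (≤-trans (s≤s z≤n) a≥2) (inj₁ refl))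
  lattice-column-term {suc j} 1+j≤a =
    splits-through⇒term a<x b<x (initial-term (≤-trans (s≤s z≤n) b≥2) (inj₂ refl)) (lattice-column-term (<⇒≤ 1+j≤a))
      (x∙yz≈y∙xz b a (j * b)) b≢ through
    where
      x = a + suc j * b
      a<x : a < x
      a<x = m<m+n a (≤-trans (≤-trans (s≤s z≤n) b≥2) (m≤m+n b (j * b)))
      b<x : b < x
      b<x = subst (b <_) (x∙yz≈y∙xz b a (j * b)) (m<m+n b (≤-trans (≤-trans (s≤s z≤n) a≥2) (m≤m+n a (j * b))))
      b≢ : b ≢ a + j * b
      b≢ b≡ = coprime⇒∤ cop b≥2 (∣m+n∣m⇒∣n (subst (b ∣_) (trans b≡ (+-comm a (j * b))) ∣-refl) (n∣m*n j))
      through : ∀ {u v} → Split x u v → u ≡ b ⊎ v ≡ b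
      through {u} {v} s@(split tu tv _ _) with term⇒lattice u tu | term⇒lattice v tv
      ... | i₁ , j₁ , refl | i₂ , j₂ , refl with lattice≡column cop b≥2 1+j≤a (split-coordinates i₁ j₁ i₂ j₂ s)
      ...   | inj₁ (I≡1 , J≡) = through-axis i₁ i₂ s I≡1 (≤-trans (≤-reflexive J≡) 1+j≤a)
        where
          through-axis : ∀ i₁ i₂ → Split x (i₁ * a + j₁ * b) (i₂ * a + j₂ * b) → i₁ + i₂ ≡ 1 → j₁ + j₂ ≤ a →
                         i₁ * a + j₁ * b ≡ b ⊎ i₂ * a + j₂ * b ≡ b
          through-axis zero          _          (split tu _ _ _) _ J≤a =
            inj₁ (trans (cong (_* b) (b-multiple⇒unit tu (m+n≤o⇒m≤o j₁ J≤a))) (*-identityˡ b))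
          through-axis (suc zero)    zero       (split _ tv _ _) _ J≤a =
            inj₂ (trans (cong (_* b) (b-multiple⇒unit tv (m+n≤o⇒n≤o j₁ J≤a))) (*-identityˡ b))
      ...   | inj₂ (J≡0 , I≤1+b) with m+n≡0⇒m≡0 j₁ J≡0 | m+n≡0⇒n≡0 j₁ {j₂} J≡0
      ...     | refl | refl = ⊥-elim (split-multiples⇒upper≢1 a i₁ i₂ s′ (a-multiple⇒unit (Split.upper-term s′) (upper≤b i₁ s′ I≤1+b)))
        where
          s′ = split-on-a-axis i₁ i₂ s
          upper≤b : ∀ i₁ → Split x (i₁ * a) (i₂ * a) → i₁ + i₂ ≤ suc b → i₂ ≤ b
          upper≤b zero    (split (listed ()) _ _ _)
          upper≤b (suc i₁) _ (s≤s I≤b) = m+n≤o⇒n≤o i₁ I≤b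

module _ {a : ℕ} (a≥2 : 2 ≤ a) where
  open Ulam a 1

  ¬term-between : ∀ x → 2 ≤ x → x < a → ¬ Term x
  ¬term-between = <-rec (λ x → 2 ≤ x → x < a → ¬ Term x) go
    where
      go : ∀ x → (∀ {y} → y < x → 2 ≤ y → y < a → ¬ Term y) → 2 ≤ x → x < a → ¬ Term x
      go x ih 2≤x x<a t with term-split t
      ... | inj₁ (inj₁ refl) = <-irrefl refl x<a
      ... | inj₁ (inj₂ refl) = <-irrefl refl 2≤x
      ... | inj₂ (_ , _ , s@(split tu tv _ u<v)) =
        ih (split-upper< s) (≤-trans (s≤s (term-pos tu)) u<v) (<-trans (split-upper< s) x<a) tv

  unit-column-term : ∀ {j} → j ≤ a → Term (a + j * 1)
  unit-column-term {zero} _ = subst Term (sym (+-identityʳ a)) (initial-term (≤-trans (s≤s z≤n) a≥2) (inj₁ refl))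
  unit-column-term {suc j} 1+j≤a =
    splits-through⇒term a<x (≤-trans a≥2 (m≤m+n a _)) (initial-term (s≤s z≤n) (inj₂ refl))
      (unit-column-term (<⇒≤ 1+j≤a)) (sym (+-suc a (j * 1))) 1≢ (inj₁ ∘ through)
    where
      x = a + suc j * 1
      a<x : a < x
      a<x = m<m+n a (s≤s z≤n)
      1≢ : 1 ≢ a + j * 1
      1≢ 1≡ = <-irrefl 1≡ (≤-trans a≥2 (m≤m+n a (j * 1)))
      through : ∀ {u v} → Split x u v → u ≡ 1
      through {zero}        (split (listed ()) _ _ _)
      through {suc zero}    _ = refl
      through {suc (suc k)} (split tu _ sum u<v) with suc (suc k) <? a
      ... | yes u<a = ⊥-elim (¬term-between (suc (suc k)) (s≤s (s≤s z≤n)) u<a tu)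
      ... | no u≮a  = ⊥-elim (<-irrefl refl (+-cancelˡ-≤ a (suc a) a (begin
            a + suc a            ≤⟨ +-mono-≤ a≤u (≤-trans (s≤s a≤u) u<v) ⟩
            suc (suc k) + _      ≡⟨ sum ⟩
            a + suc j * 1        ≤⟨ +-monoʳ-≤ a (≤-trans (≤-reflexive (*-identityʳ (suc j))) 1+j≤a) ⟩
            a + a                ∎)))
        where
          open ≤-Reasoning
          a≤u = ≮⇒≥ u≮a

column-term : ∀ {a b} → 2 ≤ a → 0 < b → Coprime a b → ∀ {j} → j ≤ a → Ulam.Term a b (a + j * b)
column-term {b = suc zero}    a≥2 _ _   = unit-column-term a≥2
column-term {b = suc (suc _)} a≥2 _ cop = lattice-column-term a≥2 (s≤s (s≤s z≤n)) cop

m*2+[2*k]*n≡[m+k*n]*2 : ∀ m k n → m * 2 + (2 * k) * n ≡ (m + k * n) * 2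
m*2+[2*k]*n≡[m+k*n]*2 = solve-∀

isEvenᵇ : ℕ → Bool
isEvenᵇ u = u % 2 ≡ᵇ 0

even-column-terms : ∀ {a b} → 2 ∣ a → 0 < a → 0 < b → Coprime a b → ∃[ N ] (1 + a / 2 ≤ evenTermsUpTo a b N)
even-column-terms {a} {b} 2∣a a>0 b>0 cop with ∣⇒≤ {{>-nonZero a>0}} 2∣a | 2∣a
... | a≥2 | divides-refl m =
  f m , subst (_< evenTermsUpTo (m * 2) b (f m)) (sym (m*n/n≡m m 2))
          (Ulam.count-increasing-terms (m * 2) b isEvenᵇ f f-increasing m even-term)
  where
    instance
      b-nonZero : NonZero b
      b-nonZero = >-nonZero b>0
    f : ℕ → ℕ
    f k = m * 2 + (2 * k) * b
    f-increasing : ∀ k → f k < f (suc k)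
    f-increasing k = +-monoʳ-< (m * 2) (*-monoˡ-< b (*-monoʳ-< 2 (n<1+n k)))
    even-term : ∀ {k} → k ≤ m → Ulam.Term (m * 2) b (f k) × T (isEvenᵇ (f k))
    even-term {k} k≤m =
      column-term a≥2 b>0 cop (subst (2 * k ≤_) (*-comm 2 m) (*-monoʳ-≤ 2 k≤m)) ,
      ≡⇒≡ᵇ _ 0 (trans (cong (_% 2) (m*2+[2*k]*n≡[m+k*n]*2 m k b)) (m*n%n≡0 (m + k * b) 2))

evenTermsUpTo-comm : ∀ a b N → evenTermsUpTo a b N ≡ evenTermsUpTo b a N
evenTermsUpTo-comm a b N = cong (count isEvenᵇ) (ulamUpTo-comm a b N)

theorem1p6 : (a b : ℕ) → 0 < a → 0 < b → a ≢ b → Coprime a b → (2 ∣ a ⊎ 2 ∣ b) →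
    ((2 ∣ a → ∃[ N ] (1 + a / 2 ≤ evenTermsUpTo a b N)) ×
     (2 ∣ b → ∃[ N ] (1 + b / 2 ≤ evenTermsUpTo a b N)))
theorem1p6 a b a>0 b>0 _ cop _ =
  (λ 2∣a → even-column-terms 2∣a a>0 b>0 cop) ,
  (λ 2∣b → map₂ (λ {N} → subst (1 + b / 2 ≤_) (evenTermsUpTo-comm b a N))
                (even-column-terms 2∣b b>0 a>0 (coprime-sym cop)))
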